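{- Let $(\sigma,\alpha)$ be a rating system and $A<B$. Suppose its $K$-function is constant over $(A,B)$ and $\sigma$ is separable over $(A,B)$ with a linear bisector, i.e., there is a constant $m$ such that $\sigma(x,y)=mx-my+0.5$ for all $x,y\in(A,B)$. Then the rating system is strongly opponent indifferent over $(A,B)$.
   Context: A rating system is a pair $(\sigma,\alpha)$ where $\sigma:\mathbb{R}^2\to[0,1]$ (the skill curve) is continuous, weakly increasing in its first argument, weakly decreasing in its second argument, and satisfies $\sigma(x,y)+\sigma(y,x)=1$ for all $x,y$; and $\alpha:\mathbb{R}^2\to\mathbb{R}_{\ge 0}$. The expected gain function is $\gamma(x,x^*\mid y,y^*) := \alpha(x,y)\sigma(x^*,y^*)-\alpha(y,x)\sigma(y^*,x^*)$, and it is required that $\gamma(x,x\mid y,y)=0$ for all $x,y$. The $K$-function is $K(x,y):=\alpha(x,y)+\alpha(y,x)$; it is constant over $(A,B)$ if $K(x,y)=C$ for some constant $C$ and all $x,y\in(A,B)$. The system is strongly opponent indifferent over $(A,B)$ if there is a function $\gamma^*:\mathbb{R}^3\to\mathbb{R}$ such that $\gamma(x,x^*\mid y,y+\delta)=\gamma^*(x,x^*,\delta)$ for all $x,x^*,y,\delta$ with $x,x^*,y,y+\delta\in(A,B)$. -}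

module Defs where

open import Level using (0ℓ)
open import Data.Product using (Σ; _×_; _,_)
open import Relation.Binary.PropositionalEquality using (_≡_; _≢_)
open import Relation.Nullary using (¬_)
open import Algebra.Structures using (IsCommutativeRing)
open import Relation.Binary.Structures using (IsTotalOrder)

-- An axiomatisation of the real numbers: a complete ordered field.
-- (All models are isomorphic, so quantifying over them is the statement about ℝ.)
record RealField : Set₁ where
  infixl 6 _+_ _-_
  infixl 7 _*_
  infix 4 _≤_ _<_
  field
    Carrier : Set
    _+_ _*_ : Carrier → Carrier → Carrier
    -_      : Carrier → Carrier
    0# 1#   : Carrier
    _⁻¹     : Carrier → Carrier
    _≤_     : Carrier → Carrier → Set
    isCommutativeRing : IsCommutativeRing _≡_ _+_ _*_ -_ 0# 1#
    0≢1       : 0# ≢ 1#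
    ⁻¹-inverse : ∀ x → x ≢ 0# → x * (x ⁻¹) ≡ 1#
    isTotalOrder : IsTotalOrder _≡_ _≤_
    +-mono-≤  : ∀ {x y} z → x ≤ y → (x + z) ≤ (y + z)
    *-nonneg  : ∀ {x y} → 0# ≤ x → 0# ≤ y → 0# ≤ (x * y)
    sup : (P : Carrier → Set) → Σ Carrier P →
          Σ Carrier (λ b → ∀ x → P x → x ≤ b) →
          Σ Carrier (λ s → (∀ x → P x → x ≤ s) ×
                           (∀ b → (∀ x → P x → x ≤ b) → s ≤ b))

  _-_ : Carrier → Carrier → Carrier
  x - y = x + (- y)

  _<_ : Carrier → Carrier → Set
  x < y = (x ≤ y) × (x ≢ y)

  2# : Carrier
  2# = 1# + 1#

  half : Carrier
  half = 2# ⁻¹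

module _ (ℝ : RealField) where
  open RealField ℝ

  InOpen : Carrier → Carrier → Carrier → Set
  InOpen A B x = (A < x) × (x < B)

  Close : Carrier → Carrier → Carrier → Set
  Close a b d = ((a - b) < d) × ((b - a) < d)

  Continuous₂ : (Carrier → Carrier → Carrier) → Set
  Continuous₂ f = ∀ x y ε → 0# < ε →
    Σ Carrier (λ δ → (0# < δ) × (∀ x' y' → Close x' x δ → Close y' y δ →
                                   Close (f x' y') (f x y) ε))

  record RatingSystem : Set where
    field
      σ : Carrier → Carrier → Carrier
      α : Carrier → Carrier → Carrier
      σ-cont   : Continuous₂ σ
      σ-range  : ∀ x y → (0# ≤ σ x y) × (σ x y ≤ 1#)
      σ-mono₁  : ∀ x x' y → x ≤ x' → σ x y ≤ σ x' y
      σ-mono₂  : ∀ x y y' → y ≤ y' → σ x y' ≤ σ x y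
      σ-sym    : ∀ x y → σ x y + σ y x ≡ 1#
      α-nonneg : ∀ x y → 0# ≤ α x y

    γ : Carrier → Carrier → Carrier → Carrier → Carrier
    γ x x* y y* = α x y * σ x* y* - α y x * σ y* x*

    field
      γ-zero : ∀ x y → γ x x y y ≡ 0#

    K : Carrier → Carrier → Carrier
    K x y = α x y + α y x

  module _ (R : RatingSystem) (A B : Carrier) where
    open RatingSystem R

    KConstantOver : Set
    KConstantOver = Σ Carrier λ C → ∀ x y → InOpen A B x → InOpen A B y → K x y ≡ C

    LinearBisectorOver : Set
    LinearBisectorOver = Σ Carrier λ m → ∀ x y → InOpen A B x → InOpen A B y →
      σ x y ≡ m * x - m * y + half

    StronglyOpponentIndifferentOver : Set
    StronglyOpponentIndifferentOver =
      Σ (Carrier → Carrier → Carrier → Carrier) λ γ* →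
        ∀ x x* y δ → InOpen A B x → InOpen A B x* → InOpen A B y →
          InOpen A B (y + δ) → γ x x* y (y + δ) ≡ γ* x x* δ

-- On (A,B) the bisector makes σ(s,t) = ℓ(s) − ℓ(t) + ½ with ℓ(s) = m s, so swapping the
-- arguments only flips the sign of the ℓ-part.  Hence γ(u,s | v,t) = K(u,v)(ℓ s − ℓ t) + E(u,v),
-- where E(u,v) does not depend on s and t.  Subtracting the normalisation γ(x,x | y,y) = 0
-- eliminates E, leaving γ(x,x* | y,y*) = K(x,y)((ℓ x* − ℓ y*) − (ℓ x − ℓ y)); for y* = y + δ
-- and K = C on (A,B) this is C((m x* − m x) − m δ), which no longer mentions y.
module Submission where

open import Defs
open import Data.Product using (_,_)
open import Algebra.Bundles using (CommutativeRing)

module CommutativeRingProperties {c ℓ} (R : CommutativeRing c ℓ) where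
  open CommutativeRing R
  open import Algebra.Properties.Ring ring using (-‿distribʳ-*; -‿involutive; -‿+-comm; -0#≈0#)
  open import Algebra.Solver.CommutativeMonoid +-commutativeMonoid using (solve; _⊜_; _⊕_)
  open import Relation.Binary.Reasoning.Setoid setoid

  x≈x-0 : ∀ x → x ≈ x - 0#
  x≈x-0 x = sym (trans (+-congˡ -0#≈0#) (+-identityʳ x))

  [x+z]-[y+z]≈x-y : ∀ x y z → (x + z) - (y + z) ≈ x - y
  [x+z]-[y+z]≈x-y x y z = begin
    (x + z) - (y + z)      ≈⟨ +-congˡ (-‿+-comm y z) ⟨
    (x + z) + (- y + - z)  ≈⟨ solve 4 (λ a b c d → (a ⊕ b) ⊕ (c ⊕ d) ⊜ (a ⊕ c) ⊕ (b ⊕ d)) refl x z (- y) (- z) ⟩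
    (x - y) + (z - z)      ≈⟨ +-congˡ (-‿inverseʳ z) ⟩
    (x - y) + 0#           ≈⟨ +-identityʳ (x - y) ⟩
    x - y                  ∎

  [p-[y+d]]-[x-y]≈[p-x]-d : ∀ p x y d → (p - (y + d)) - (x - y) ≈ (p - x) - d
  [p-[y+d]]-[x-y]≈[p-x]-d p x y d = begin
    (p - (y + d)) - (x - y)            ≈⟨ +-cong (+-congˡ (-‿+-comm y d)) (-‿+-comm x (- y)) ⟨
    (p + (- y + - d)) + (- x + - - y)  ≈⟨ +-congˡ (+-congˡ (-‿involutive y)) ⟩
    (p + (- y + - d)) + (- x + y)      ≈⟨ solve 5 (λ a b c d e → (a ⊕ (b ⊕ c)) ⊕ (d ⊕ e) ⊜ ((a ⊕ d) ⊕ c) ⊕ (e ⊕ b))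
                                               refl p (- y) (- d) (- x) y ⟩
    ((p - x) - d) + (y - y)            ≈⟨ +-congˡ (-‿inverseʳ y) ⟩
    ((p - x) - d) + 0#                 ≈⟨ +-identityʳ ((p - x) - d) ⟩
    (p - x) - d                        ∎

  a[p+h]-b[-p+h]≈[a+b]p+[ah-bh] : ∀ a b p h →
    a * (p + h) - b * (- p + h) ≈ (a + b) * p + (a * h - b * h)
  a[p+h]-b[-p+h]≈[a+b]p+[ah-bh] a b p h = begin
    a * (p + h) - b * (- p + h)                ≈⟨ +-cong (distribˡ a p h) (-‿cong (distribˡ b (- p) h)) ⟩
    (a * p + a * h) - (b * - p + b * h)        ≈⟨ +-congˡ (-‿+-comm (b * - p) (b * h)) ⟨
    (a * p + a * h) + (- (b * - p) - b * h)    ≈⟨ +-congˡ (+-congʳ (-‿cong (-‿distribʳ-* b p))) ⟨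
    (a * p + a * h) + (- - (b * p) - b * h)    ≈⟨ +-congˡ (+-congʳ (-‿involutive (b * p))) ⟩
    (a * p + a * h) + (b * p - b * h)          ≈⟨ solve 4 (λ w x y z → (w ⊕ x) ⊕ (y ⊕ z) ⊜ (w ⊕ y) ⊕ (x ⊕ z))
                                                       refl (a * p) (a * h) (b * p) (- (b * h)) ⟩
    (a * p + b * p) + (a * h - b * h)          ≈⟨ +-congʳ (distribʳ p a b) ⟨
    (a + b) * p + (a * h - b * h)              ∎

module _ (ℝ : RealField) where
  open RealField ℝ

  commutativeRing : CommutativeRing _ _
  commutativeRing = record { isCommutativeRing = isCommutativeRing }

  open CommutativeRingProperties commutativeRing
  open import Algebra.Properties.Ring (CommutativeRing.ring commutativeRing) using (⁻¹-anti-homo‿-; x[y-z]≈xy-xz)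
  open import Relation.Binary.PropositionalEquality using (_≡_; sym; trans; cong; cong₂; module ≡-Reasoning)
  open ≡-Reasoning

  module _ (R : RatingSystem ℝ) (A B : Carrier) where
    open RatingSystem R

    SeparableOver : (Carrier → Carrier) → Carrier → Set
    SeparableOver f h = ∀ s t → InOpen ℝ A B s → InOpen ℝ A B t → σ s t ≡ f s - f t + h

    module _ {f : Carrier → Carrier} {h : Carrier} (separable : SeparableOver f h) where

      γ-separable : ∀ u v s t → InOpen ℝ A B s → InOpen ℝ A B t →
        γ u s v t ≡ K u v * (f s - f t) + (α u v * h - α v u * h)
      γ-separable u v s t s∈ t∈ = begin
        α u v * σ s t - α v u * σ t s
          ≡⟨ cong₂ (λ p q → α u v * p - α v u * q) (separable s t s∈ t∈)
                   (trans (separable t s t∈ s∈) (cong (_+ h) (sym (⁻¹-anti-homo‿- (f s) (f t))))) ⟩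
        α u v * (f s - f t + h) - α v u * (- (f s - f t) + h)
          ≡⟨ a[p+h]-b[-p+h]≈[a+b]p+[ah-bh] (α u v) (α v u) (f s - f t) h ⟩
        K u v * (f s - f t) + (α u v * h - α v u * h)
          ∎

      γ-separable-increment : ∀ x x* y y* → InOpen ℝ A B x → InOpen ℝ A B x* →
        InOpen ℝ A B y → InOpen ℝ A B y* →
        γ x x* y y* ≡ K x y * ((f x* - f y*) - (f x - f y))
      γ-separable-increment x x* y y* x∈ x*∈ y∈ y*∈ = begin
        γ x x* y y*
          ≡⟨ x≈x-0 (γ x x* y y*) ⟩
        γ x x* y y* - 0#
          ≡⟨ cong (λ g → γ x x* y y* - g) (sym (γ-zero x y)) ⟩
        γ x x* y y* - γ x x y y
          ≡⟨ cong₂ _-_ (γ-separable x y x* y* x*∈ y*∈) (γ-separable x y x y x∈ y∈) ⟩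
        (K x y * (f x* - f y*) + E) - (K x y * (f x - f y) + E)
          ≡⟨ [x+z]-[y+z]≈x-y (K x y * (f x* - f y*)) (K x y * (f x - f y)) E ⟩
        K x y * (f x* - f y*) - K x y * (f x - f y)
          ≡⟨ sym (x[y-z]≈xy-xz (K x y) _ _) ⟩
        K x y * ((f x* - f y*) - (f x - f y))
          ∎
        where E = α x y * h - α y x * h

lemma33 : (ℝ : RealField) (R : RatingSystem ℝ) (A B : RealField.Carrier ℝ) →
          RealField._<_ ℝ A B →
          KConstantOver ℝ R A B → LinearBisectorOver ℝ R A B →
          StronglyOpponentIndifferentOver ℝ R A B
lemma33 ℝ R A B _ (C , K≡C) (m , σ-linear) = γ* , γ≡γ*
  where
  open RealField ℝ
  open RatingSystem R
  open import Relation.Binary.PropositionalEquality using (_≡_; cong; cong₂; module ≡-Reasoning)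
  open CommutativeRing (commutativeRing ℝ) using (distribˡ)
  open CommutativeRingProperties (commutativeRing ℝ) using ([p-[y+d]]-[x-y]≈[p-x]-d)
  open ≡-Reasoning

  γ* : Carrier → Carrier → Carrier → Carrier
  γ* x x* δ = C * ((m * x* - m * x) - m * δ)

  γ≡γ* : ∀ x x* y δ → InOpen ℝ A B x → InOpen ℝ A B x* → InOpen ℝ A B y →
         InOpen ℝ A B (y + δ) → γ x x* y (y + δ) ≡ γ* x x* δ
  γ≡γ* x x* y δ x∈ x*∈ y∈ y+δ∈ = begin
    γ x x* y (y + δ)
      ≡⟨ γ-separable-increment ℝ R A B σ-linear x x* y (y + δ) x∈ x*∈ y∈ y+δ∈ ⟩
    K x y * ((m * x* - m * (y + δ)) - (m * x - m * y))
      ≡⟨ cong₂ (λ k q → k * ((m * x* - q) - (m * x - m * y))) (K≡C x y x∈ y∈) (distribˡ m y δ) ⟩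
    C * ((m * x* - (m * y + m * δ)) - (m * x - m * y))
      ≡⟨ cong (C *_) ([p-[y+d]]-[x-y]≈[p-x]-d (m * x*) (m * x) (m * y) (m * δ)) ⟩
    γ* x x* δ
      ∎
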